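{- In the construction below, if there is a labeling $f:V_H\to[d]$ satisfying at least a $1-\eta$ fraction of the edges of the Unique Label Cover instance $H$, then there is a cut in $(G,D)$ of capacity at most $1+\alpha/2$ that separates at least $1-\eta$ units of demand.
   Context: A Unique Label Cover instance is a multigraph $H=(V_H,E_H)$ with, for each edge $(v,w)\in E_H$, a bijection $\sigma_{vw}:[d]\to[d]$; a labeling $f:V_H\to[d]$ satisfies $(v,w)$ if $\sigma_{vw}(f(v))=f(w)$; fractions of edges count parallel edges with multiplicity. $H$ is $\Delta$-nice if, with $n=|V_H|$, $E_H$ is an edge-disjoint union of $n$ cliques, each a complete graph on a set of $\Delta$ vertices, and each vertex lies in exactly $\Delta$ of these cliques; thus $m:=|E_H|=n\binom{\Delta}{2}$. For $x\in\{ -1,1\}^d$ and a permutation $\sigma$ of $[d]$, $\sigma(x)=(x_{\sigma^{ -1}(1)},\dots,x_{\sigma^{ -1}(d)})$ and $\overline{x}=(-x_1,\dots,-x_d)$. Construction: given a $\Delta$-nice instance $H$ and a parameter $\alpha>0$, let $N=n2^d$, $M=m2^d$. The Sparsest Cut instance $(G,D)$ has vertices $s,t$ and a cube $Q_v=\{ -1,1\}^d$ for each $v\in V_H$ (disjoint copies). Supply edges: $s$ to every cube vertex and $t$ to every cube vertex, each of capacity $1/N$ (star edges); within each $Q_v$, every pair of points differing in exactly one coordinate, with capacity $\alpha/N$ (cube edges). Demands: for each edge $(v,w)\in E_H$ (with multiplicity) and each $x\in\{ -1,1\}^d$, a demand of $1/M$ between $x\in Q_v$ and $\overline{\sigma_{vw}(x)}\in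 Q_w$. The capacity of a cut is the total capacity of crossing supply edges; the demand it separates is the total crossing demand.
   Formalization: The parameters α and η range over the rationals. -}

module Defs where

open import Data.Nat as ℕ using (ℕ; zero; suc; NonZero; _^_)
open import Data.Nat.Properties using (m*n≢0; m^n≢0)
open import Data.Integer using (+_)
open import Data.Fin as Fin using (Fin; zero; suc)
open import Data.Fin.Permutation using (Permutation′; _⟨$⟩ʳ_; _⟨$⟩ˡ_)
open import Data.Bool using (Bool; true; false; not; if_then_else_; _xor_)
open import Data.Vec.Functional using (Vector; _∷_; updateAt)
open import Data.Product using (Σ; _×_; _,_; proj₁; proj₂)
open import Data.Sum using (_⊎_)
open import Function.Bundles using (_↔_; Inverse)
open import Function.Definitions using (Injective)
open import Relation.Binary.PropositionalEquality using (_≡_)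
open import Relation.Nullary.Decidable using (⌊_⌋)
open import Data.Rational using (ℚ; 0ℚ; 1ℚ; _+_; _*_; _/_)

sumFin : (k : ℕ) → (Fin k → ℚ) → ℚ
sumFin zero    g = 0ℚ
sumFin (suc k) g = g zero + sumFin k (λ i → g (suc i))

-- Points of the cube {-1,1}^d, encoded as Bool-vectors
-- (true ↦ +1, false ↦ -1).
Cube : ℕ → Set
Cube d = Vector Bool d

sumCube : (d : ℕ) → (Cube d → ℚ) → ℚ
sumCube zero    g = g (λ ())
sumCube (suc d) g = sumCube d (λ x → g (true ∷ x)) + sumCube d (λ x → g (false ∷ x))

ind : Bool → ℚ
ind b = if b then 1ℚ else 0ℚ

record ULC (n d m : ℕ) : Set where
  field
    src  : Fin m → Fin n
    tgt  : Fin m → Fin n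
    perm : Fin m → Permutation′ d
open ULC public

satisfiesᵇ : ∀ {n d m} → ULC n d m → (Fin n → Fin d) → Fin m → Bool
satisfiesᵇ H f e = ⌊ perm H e ⟨$⟩ʳ f (src H e) Fin.≟ f (tgt H e) ⌋

satCount : ∀ {n d m} → ULC n d m → (Fin n → Fin d) → ℕ
satCount {m = m} H f = count m (satisfiesᵇ H f)
  where
  count : (k : ℕ) → (Fin k → Bool) → ℕ
  count zero    p = 0
  count (suc k) p = (if p zero then 1 else 0) ℕ.+ count k (λ i → p (suc i))

satFraction : ∀ {n d m} .{{_ : NonZero m}} → ULC n d m → (Fin n → Fin d) → ℚ
satFraction {m = m} H f = + satCount H f / m

-- Δ-nice: E_H is an edge-disjoint union of n cliques, each a complete
-- graph on a set of Δ vertices, and each vertex lies in exactly Δ cliques.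
record IsNice {n d m : ℕ} (H : ULC n d m) (Δ : ℕ) : Set where
  field
    clique     : Fin n → Fin Δ → Fin n
    clique-inj : ∀ c → Injective _≡_ _≡_ (clique c)
    -- every edge of H is exactly one edge {clique c i, clique c j}, i < j,
    -- of exactly one clique c, and every such clique edge occurs once
    decomp     : Fin m ↔ Σ (Fin n) (λ c → Σ (Fin Δ × Fin Δ) (λ ij → proj₁ ij Fin.< proj₂ ij))
    endpoints  : ∀ e →
      let c = proj₁ (Inverse.to decomp e)
          i = proj₁ (proj₁ (proj₂ (Inverse.to decomp e)))
          j = proj₂ (proj₁ (proj₂ (Inverse.to decomp e)))
      in (src H e ≡ clique c i × tgt H e ≡ clique c j)
         ⊎ (src H e ≡ clique c j × tgt H e ≡ clique c i)
    membership : ∀ v → Fin Δ ↔ Σ (Fin n) (λ c → Σ (Fin Δ) (λ i → clique c i ≡ v))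

applyPerm : ∀ {d} → Permutation′ d → Cube d → Cube d
applyPerm σ x i = x (σ ⟨$⟩ˡ i)

negate : ∀ {d} → Cube d → Cube d
negate x i = not (x i)

flipAt : ∀ {d} → Fin d → Cube d → Cube d
flipAt i x = updateAt x i not

data VG (n d : ℕ) : Set where
  s t  : VG n d
  cube : Fin n → Cube d → VG n d

Cut : ℕ → ℕ → Set
Cut n d = VG n d → Bool

crosses : ∀ {n d} → Cut n d → VG n d → VG n d → Bool
crosses S a b = S a xor S b

invScale : (k d : ℕ) .{{_ : NonZero k}} → ℚ
invScale k d = + 1 / (k ℕ.* 2 ^ d)
  where
  instance
    _ = m^n≢0 2 d
    _ = m*n≢0 k (2 ^ d)

-- capacity of the cut: star edges (capacity 1/N) plus cube edges
-- (capacity α/N); each cube edge {x, x with coord i flipped} is counted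
-- once, via its endpoint x with x_i = +1.
capacity : ∀ {n d} .{{_ : NonZero n}} → ℚ → Cut n d → ℚ
capacity {n} {d} α S =
    sumFin n (λ v → sumCube d (λ x →
        ind (crosses S s (cube v x)) * invScale n d
      + ind (crosses S t (cube v x)) * invScale n d))
  + sumFin n (λ v → sumCube d (λ x → sumFin d (λ i →
        (if x i then ind (crosses S (cube v x) (cube v (flipAt i x))) else 0ℚ)
          * (α * invScale n d))))

separatedDemand : ∀ {n d m} .{{_ : NonZero m}} → ULC n d m → Cut n d → ℚ
separatedDemand {n} {d} {m} H S =
  sumFin m (λ e → sumCube d (λ x →
    ind (crosses S (cube (src H e) x)
                   (cube (tgt H e) (negate (applyPerm (perm H e) x))))
      * invScale m d))

module Submission where

-- Let S contain s and, in each cube Q_v, the half-cube {x | x_{f(v)} = +1}.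
-- Every cube point is separated from exactly one of s, t, so the star edges
-- cost N · 1/N = 1; in Q_v only the 2^{d-1} edges in direction f(v) are cut,
-- so the cube edges cost n 2^{d-1} · α/N = α/2.  If f satisfies (v,w), then
-- σ_vw(x) has x_{f(v)} in coordinate f(w), so x and \overline{σ_vw(x)} lie on
-- opposite sides: every satisfied edge contributes all its 2^d demands.

open import Defs
open import Data.Nat as ℕ using (ℕ; NonZero; zero; suc; _^_)
open import Data.Nat.Properties using (m*n≢0; m^n≢0; *-comm)
open import Data.Nat.Tactic.RingSolver using (solve-∀)
open import Data.Integer using (+_)
import Data.Integer as ℤ
import Data.Integer.Properties as ℤ
open import Data.Rational using (ℚ; 0ℚ; 1ℚ; ½; _+_; _*_; _-_; _≤_; _<_; _/_; NonNegative; toℚᵘ)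
open import Data.Rational.Properties as ℚ
  using (toℚᵘ-injective; toℚᵘ-fromℚᵘ; toℚᵘ-homo-*; toℚᵘ-homo-+;
         +-identityˡ; +-identityʳ; *-identityˡ; *-zeroˡ; *-distribʳ-+;
         ≤-refl; ≤-reflexive; ≤-trans; +-mono-≤; *-monoʳ-≤-nonNeg;
         nonNegative⁻¹; normalize-nonNeg)
open import Data.Rational.Unnormalised using (mkℚᵘ; *≡*) renaming (_≃_ to _≃ᵘ_)
import Data.Rational.Unnormalised.Properties as ℚᵘ
open import Algebra.Bundles using (CommutativeMonoid)
open import Algebra.Properties.CommutativeSemigroup
  (CommutativeMonoid.commutativeSemigroup ℚ.*-1-commutativeMonoid) using (x∙yz≈y∙xz)
open import Data.Fin using (Fin; zero; suc; _≟_)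
open import Data.Fin.Permutation using (Permutation′; _⟨$⟩ʳ_; inverseˡ)
open import Data.Bool using (true; false; not; if_then_else_; _xor_)
open import Data.Bool.Properties using (xor-same; not-distribʳ-xor)
open import Data.Vec.Functional using (_∷_)
open import Data.Vec.Functional.Properties using (updateAt-updates; updateAt-minimal)
open import Data.Product using (Σ; _×_; _,_)
open import Data.Empty using (⊥-elim)
open import Function.Base using (it)
open import Relation.Nullary using (¬_; yes; no)
open import Relation.Binary.PropositionalEquality
  using (_≡_; _≢_; refl; sym; trans; cong; cong₂; module ≡-Reasoning)

fromℕ : ℕ → ℚ
fromℕ a = + a / 1

toℚᵘ-/ : ∀ a b → toℚᵘ (+ a / suc b) ≃ᵘ mkℚᵘ (+ a) b
toℚᵘ-/ a b = toℚᵘ-fromℚᵘ (mkℚᵘ (+ a) b)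

/-≡-cross : ∀ a b c e .{{_ : NonZero b}} .{{_ : NonZero e}} →
            a ℕ.* e ≡ c ℕ.* b → + a / b ≡ + c / e
/-≡-cross a (suc b) c (suc e) eq = toℚᵘ-injective (ℚᵘ.≃-trans (toℚᵘ-/ a b)
  (ℚᵘ.≃-trans (*≡* (trans (sym (ℤ.pos-* a (suc e))) (trans (cong +_ eq) (ℤ.pos-* c (suc b)))))
              (ℚᵘ.≃-sym (toℚᵘ-/ c e))))

/-homo-* : ∀ a b c e .{{_ : NonZero b}} .{{_ : NonZero e}} →
           (+ a / b) * (+ c / e) ≡ (+ (a ℕ.* c) / (b ℕ.* e)) {{m*n≢0 b e}}
/-homo-* a (suc b) c (suc e) = toℚᵘ-injective
  (ℚᵘ.≃-trans (toℚᵘ-homo-* (+ a / suc b) (+ c / suc e))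
  (ℚᵘ.≃-trans (ℚᵘ.*-cong (toℚᵘ-/ a b) (toℚᵘ-/ c e))
  (ℚᵘ.≃-trans (*≡* (cong (ℤ._* (+ (suc b ℕ.* suc e))) (sym (ℤ.pos-* a c))))
              (ℚᵘ.≃-sym (toℚᵘ-/ (a ℕ.* c) _)))))

fromℕ-homo-+ : ∀ a c → fromℕ a + fromℕ c ≡ fromℕ (a ℕ.+ c)
fromℕ-homo-+ a c = toℚᵘ-injective
  (ℚᵘ.≃-trans (toℚᵘ-homo-+ (fromℕ a) (fromℕ c))
  (ℚᵘ.≃-trans (ℚᵘ.+-cong (toℚᵘ-/ a 0) (toℚᵘ-/ c 0))
  (ℚᵘ.≃-trans (*≡* (cong (ℤ._* + 1) (trans (cong₂ ℤ._+_ (ℤ.*-identityʳ (+ a)) (ℤ.*-identityʳ (+ c)))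
                                           (sym (ℤ.pos-+ a c)))))
              (ℚᵘ.≃-sym (toℚᵘ-/ (a ℕ.+ c) 0)))))

fromℕ-double : ∀ a → fromℕ a + fromℕ a ≡ fromℕ (2 ℕ.* a)
fromℕ-double a = trans (fromℕ-homo-+ a a) (cong fromℕ (a+a≡2*a a))
  where
  a+a≡2*a : ∀ a → a ℕ.+ a ≡ 2 ℕ.* a
  a+a≡2*a = solve-∀

fromℕ-*-fromℕ-*-1/ : ∀ a b c .{{_ : NonZero c}} →
                     fromℕ a * (fromℕ b * (+ 1 / c)) ≡ + (a ℕ.* b) / c
fromℕ-*-fromℕ-*-1/ a b c = begin
  fromℕ a * (fromℕ b * (+ 1 / c))            ≡⟨ cong (fromℕ a *_) (/-homo-* b 1 1 c) ⟩
  fromℕ a * (+ (b ℕ.* 1) / (1 ℕ.* c))        ≡⟨ /-homo-* a 1 (b ℕ.* 1) (1 ℕ.* c) ⟩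
  + (a ℕ.* (b ℕ.* 1)) / (1 ℕ.* (1 ℕ.* c))    ≡⟨ /-≡-cross (a ℕ.* (b ℕ.* 1)) (1 ℕ.* (1 ℕ.* c)) (a ℕ.* b) c (cross a b c) ⟩
  + (a ℕ.* b) / c                            ∎
  where
  open ≡-Reasoning
  instance
    _ = m*n≢0 1 c
    _ = m*n≢0 1 (1 ℕ.* c)
  cross : ∀ a b c → a ℕ.* (b ℕ.* 1) ℕ.* c ≡ a ℕ.* b ℕ.* (1 ℕ.* (1 ℕ.* c))
  cross = solve-∀

invScale≢0 : ∀ k d .{{_ : NonZero k}} → NonZero (k ℕ.* 2 ^ d)
invScale≢0 k d = m*n≢0 k (2 ^ d) {{it}} {{m^n≢0 2 d}}

invScale-nonNeg : ∀ k d .{{_ : NonZero k}} → NonNegative (invScale k d)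
invScale-nonNeg k d = normalize-nonNeg 1 (k ℕ.* 2 ^ d) {{invScale≢0 k d}}

k*2^d*invScale≡1 : ∀ k d .{{_ : NonZero k}} → fromℕ k * (fromℕ (2 ^ d) * invScale k d) ≡ 1ℚ
k*2^d*invScale≡1 k d = trans (fromℕ-*-fromℕ-*-1/ k (2 ^ d) (k ℕ.* 2 ^ d) {{invScale≢0 k d}})
  (/-≡-cross (k ℕ.* 2 ^ d) _ 1 1 {{invScale≢0 k d}} (*-comm (k ℕ.* 2 ^ d) 1))

k*2^d*invScale[1+d]≡½ : ∀ k d .{{_ : NonZero k}} → fromℕ k * (fromℕ (2 ^ d) * invScale k (suc d)) ≡ ½
k*2^d*invScale[1+d]≡½ k d = trans (fromℕ-*-fromℕ-*-1/ k (2 ^ d) (k ℕ.* 2 ^ suc d) {{invScale≢0 k (suc d)}})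
  (/-≡-cross (k ℕ.* 2 ^ d) _ 1 2 {{invScale≢0 k (suc d)}} (cross k (2 ^ d)))
  where
  cross : ∀ k p → k ℕ.* p ℕ.* 2 ≡ 1 ℕ.* (k ℕ.* (2 ℕ.* p))
  cross = solve-∀

a*2^d*invScale≡a/m : ∀ a m d .{{_ : NonZero m}} → fromℕ a * (fromℕ (2 ^ d) * invScale m d) ≡ + a / m
a*2^d*invScale≡a/m a m d = trans (fromℕ-*-fromℕ-*-1/ a (2 ^ d) (m ℕ.* 2 ^ d) {{invScale≢0 m d}})
  (/-≡-cross (a ℕ.* 2 ^ d) _ a m {{invScale≢0 m d}} (cross a m (2 ^ d)))
  where
  cross : ∀ a m p → a ℕ.* p ℕ.* m ≡ a ℕ.* (m ℕ.* p)
  cross = solve-∀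

sumFin-cong : ∀ k {g h : Fin k → ℚ} → (∀ i → g i ≡ h i) → sumFin k g ≡ sumFin k h
sumFin-cong zero    g≡h = refl
sumFin-cong (suc k) g≡h = cong₂ _+_ (g≡h zero) (sumFin-cong k (λ i → g≡h (suc i)))

sumCube-cong : ∀ d {g h : Cube d → ℚ} → (∀ x → g x ≡ h x) → sumCube d g ≡ sumCube d h
sumCube-cong zero    g≡h = g≡h _
sumCube-cong (suc d) g≡h = cong₂ _+_ (sumCube-cong d (λ x → g≡h _)) (sumCube-cong d (λ x → g≡h _))

sumFin-mono-≤ : ∀ k {g h : Fin k → ℚ} → (∀ i → g i ≤ h i) → sumFin k g ≤ sumFin k h
sumFin-mono-≤ zero    g≤h = ≤-refl
sumFin-mono-≤ (suc k) g≤h = +-mono-≤ (g≤h zero) (sumFin-mono-≤ k (λ i → g≤h (suc i)))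

sumCube-mono-≤ : ∀ d {g h : Cube d → ℚ} → (∀ x → g x ≤ h x) → sumCube d g ≤ sumCube d h
sumCube-mono-≤ zero    g≤h = g≤h _
sumCube-mono-≤ (suc d) g≤h = +-mono-≤ (sumCube-mono-≤ d (λ x → g≤h _)) (sumCube-mono-≤ d (λ x → g≤h _))

sumFin-*ʳ : ∀ k (g : Fin k → ℚ) c → sumFin k (λ i → g i * c) ≡ sumFin k g * c
sumFin-*ʳ zero    g c = sym (*-zeroˡ c)
sumFin-*ʳ (suc k) g c = trans (cong (_+_ (g zero * c)) (sumFin-*ʳ k (λ i → g (suc i)) c))
                              (sym (*-distribʳ-+ c (g zero) _))

sumCube-*ʳ : ∀ d (g : Cube d → ℚ) c → sumCube d (λ x → g x * c) ≡ sumCube d g * c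
sumCube-*ʳ zero    g c = refl
sumCube-*ʳ (suc d) g c =
  trans (cong₂ _+_ (sumCube-*ʳ d (λ x → g (true ∷ x)) c) (sumCube-*ʳ d (λ x → g (false ∷ x)) c))
        (sym (*-distribʳ-+ c (sumCube d (λ x → g (true ∷ x))) (sumCube d (λ x → g (false ∷ x)))))

sumFin-const : ∀ k c → sumFin k (λ _ → c) ≡ fromℕ k * c
sumFin-const zero    c = sym (*-zeroˡ c)
sumFin-const (suc k) c = begin
  c + sumFin k (λ _ → c)    ≡⟨ cong₂ _+_ (sym (*-identityˡ c)) (sumFin-const k c) ⟩
  1ℚ * c + fromℕ k * c      ≡⟨ *-distribʳ-+ c 1ℚ (fromℕ k) ⟨
  (1ℚ + fromℕ k) * c        ≡⟨ cong (_* c) (fromℕ-homo-+ 1 k) ⟩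
  fromℕ (suc k) * c         ∎
  where open ≡-Reasoning

sumCube-const : ∀ d c → sumCube d (λ _ → c) ≡ fromℕ (2 ^ d) * c
sumCube-const zero    c = sym (*-identityˡ c)
sumCube-const (suc d) c = begin
  sumCube d (λ _ → c) + sumCube d (λ _ → c)  ≡⟨ cong₂ _+_ (sumCube-const d c) (sumCube-const d c) ⟩
  fromℕ (2 ^ d) * c + fromℕ (2 ^ d) * c      ≡⟨ *-distribʳ-+ c (fromℕ (2 ^ d)) (fromℕ (2 ^ d)) ⟨
  (fromℕ (2 ^ d) + fromℕ (2 ^ d)) * c        ≡⟨ cong (_* c) (fromℕ-double (2 ^ d)) ⟩
  fromℕ (2 ^ suc d) * c                      ∎
  where open ≡-Reasoning

sumCube-coordinate : ∀ d (k : Fin (suc d)) → sumCube (suc d) (λ x → ind (x k)) ≡ fromℕ (2 ^ d)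
sumCube-coordinate d zero = begin
  sumCube d (λ _ → 1ℚ) + sumCube d (λ _ → 0ℚ)   ≡⟨ cong₂ _+_ (sumCube-const d 1ℚ) (sumCube-const d 0ℚ) ⟩
  fromℕ (2 ^ d) * 1ℚ + fromℕ (2 ^ d) * 0ℚ       ≡⟨ cong₂ _+_ (ℚ.*-identityʳ (fromℕ (2 ^ d))) (ℚ.*-zeroʳ (fromℕ (2 ^ d))) ⟩
  fromℕ (2 ^ d) + 0ℚ                            ≡⟨ +-identityʳ (fromℕ (2 ^ d)) ⟩
  fromℕ (2 ^ d)                                 ∎
  where open ≡-Reasoning
sumCube-coordinate (suc d) (suc k) =
  trans (cong₂ _+_ (sumCube-coordinate d k) (sumCube-coordinate d k)) (fromℕ-double (2 ^ d))

sumFin-single : ∀ k (j : Fin k) (g : Fin k → ℚ) → (∀ i → i ≢ j → g i ≡ 0ℚ) → sumFin k g ≡ g j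
sumFin-single (suc k) zero g vanish = begin
  g zero + sumFin k (λ i → g (suc i))   ≡⟨ cong (_+_ (g zero)) (sumFin-cong k (λ i → vanish (suc i) λ ())) ⟩
  g zero + sumFin k (λ _ → 0ℚ)          ≡⟨ cong (_+_ (g zero)) (trans (sumFin-const k 0ℚ) (ℚ.*-zeroʳ (fromℕ k))) ⟩
  g zero + 0ℚ                           ≡⟨ +-identityʳ _ ⟩
  g zero                                ∎
  where open ≡-Reasoning
sumFin-single (suc k) (suc j) g vanish =
  trans (cong₂ _+_ (vanish zero λ ())
                   (sumFin-single k j (λ i → g (suc i)) (λ i i≢j → vanish (suc i) λ { refl → i≢j refl })))
        (+-identityˡ _)

xor-not : ∀ b → b xor not b ≡ true
xor-not b = trans (sym (not-distribʳ-xor b b)) (cong not (xor-same b))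

ind-nonNeg : ∀ b → 0ℚ ≤ ind b
ind-nonNeg true  = nonNegative⁻¹ 1ℚ
ind-nonNeg false = ≤-refl

applyPerm-⟨$⟩ʳ : ∀ {d} (σ : Permutation′ d) (x : Cube d) i → applyPerm σ x (σ ⟨$⟩ʳ i) ≡ x i
applyPerm-⟨$⟩ʳ σ x i = cong x (inverseˡ σ)

labelCut : ∀ {n d} → (Fin n → Fin d) → Cut n d
labelCut f s          = true
labelCut f t          = false
labelCut f (cube v x) = x (f v)

starCapacity : ∀ {n d} .{{_ : NonZero n}} → Cut n d → ℚ
starCapacity {n} {d} S = sumFin n (λ v → sumCube d (λ x →
    ind (crosses S s (cube v x)) * invScale n d
  + ind (crosses S t (cube v x)) * invScale n d))

cubeCapacity : ∀ {n d} .{{_ : NonZero n}} → ℚ → Cut n d → ℚ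
cubeCapacity {n} {d} α S = sumFin n (λ v → sumCube d (λ x → sumFin d (λ i →
    (if x i then ind (crosses S (cube v x) (cube v (flipAt i x))) else 0ℚ)
      * (α * invScale n d))))

s-t-cut-crosses-one-star-edge : ∀ {n d} (S : Cut n d) → S s ≡ true → S t ≡ false →
  ∀ a c → ind (crosses S s a) * c + ind (crosses S t a) * c ≡ c
s-t-cut-crosses-one-star-edge S Ss≡true St≡false a c rewrite Ss≡true | St≡false with S a
... | true  = trans (cong (λ z → z + 1ℚ * c) (*-zeroˡ c)) (trans (+-identityˡ _) (*-identityˡ c))
... | false = trans (cong (_+_ (1ℚ * c)) (*-zeroˡ c)) (trans (+-identityʳ _) (*-identityˡ c))

starCapacity-s-t-cut : ∀ {n d} .{{_ : NonZero n}} (S : Cut n d) → S s ≡ true → S t ≡ false →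
                       starCapacity S ≡ 1ℚ
starCapacity-s-t-cut {n} {d} S Ss≡true St≡false = begin
  starCapacity S                           ≡⟨ sumFin-cong n (λ v → sumCube-cong d (λ x →
                                                s-t-cut-crosses-one-star-edge S Ss≡true St≡false (cube v x) c)) ⟩
  sumFin n (λ _ → sumCube d (λ _ → c))     ≡⟨ sumFin-cong n (λ _ → sumCube-const d c) ⟩
  sumFin n (λ _ → fromℕ (2 ^ d) * c)       ≡⟨ sumFin-const n _ ⟩
  fromℕ n * (fromℕ (2 ^ d) * c)            ≡⟨ k*2^d*invScale≡1 n d ⟩
  1ℚ                                       ∎
  where
  open ≡-Reasoning
  c = invScale n d

labelCut-cubeEdges : ∀ {n d} (f : Fin n → Fin d) v (x : Cube d) K →
  sumFin d (λ i → (if x i then ind (crosses (labelCut f) (cube v x) (cube v (flipAt i x))) else 0ℚ) * K)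
  ≡ ind (x (f v)) * K
labelCut-cubeEdges {d = d} f v x K = trans (sumFin-single d (f v) edge other) this
  where
  edge : Fin d → ℚ
  edge i = (if x i then ind (crosses (labelCut f) (cube v x) (cube v (flipAt i x))) else 0ℚ) * K
  other : ∀ i → i ≢ f v → edge i ≡ 0ℚ
  other i i≢fv = trans (cong (λ b → (if x i then ind b else 0ℚ) * K)
                             (trans (cong (x (f v) xor_) (updateAt-minimal (f v) i x (λ fv≡i → i≢fv (sym fv≡i))))
                                    (xor-same (x (f v)))))
                       (vanish (x i))
    where
    vanish : ∀ b → (if b then ind false else 0ℚ) * K ≡ 0ℚ
    vanish true  = *-zeroˡ K
    vanish false = *-zeroˡ K
  this : edge (f v) ≡ ind (x (f v)) * K
  this = trans (cong (λ b → (if x (f v) then ind b else 0ℚ) * K)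
                     (trans (cong (x (f v) xor_) (updateAt-updates (f v) x)) (xor-not (x (f v)))))
               (select (x (f v)))
    where
    select : ∀ b → (if b then ind true else 0ℚ) * K ≡ ind b * K
    select true  = refl
    select false = refl

cubeCapacity-labelCut : ∀ {n d} .{{_ : NonZero n}} α (f : Fin n → Fin (suc d)) →
                        cubeCapacity α (labelCut f) ≡ α * ½
cubeCapacity-labelCut {n} {d} α f = begin
  cubeCapacity α (labelCut f)
    ≡⟨ sumFin-cong n (λ v → sumCube-cong (suc d) (λ x → labelCut-cubeEdges f v x (α * invScale n (suc d)))) ⟩
  sumFin n (λ v → sumCube (suc d) (λ x → ind (x (f v)) * (α * invScale n (suc d))))
    ≡⟨ sumFin-cong n (λ v → sumCube-*ʳ (suc d) (λ x → ind (x (f v))) (α * invScale n (suc d))) ⟩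
  sumFin n (λ v → sumCube (suc d) (λ x → ind (x (f v))) * (α * invScale n (suc d)))
    ≡⟨ sumFin-cong n (λ v → cong (_* (α * invScale n (suc d))) (sumCube-coordinate d (f v))) ⟩
  sumFin n (λ _ → fromℕ (2 ^ d) * (α * invScale n (suc d)))
    ≡⟨ sumFin-const n (fromℕ (2 ^ d) * (α * invScale n (suc d))) ⟩
  fromℕ n * (fromℕ (2 ^ d) * (α * invScale n (suc d)))
    ≡⟨ cong (fromℕ n *_) (x∙yz≈y∙xz (fromℕ (2 ^ d)) α (invScale n (suc d))) ⟩
  fromℕ n * (α * (fromℕ (2 ^ d) * invScale n (suc d)))
    ≡⟨ x∙yz≈y∙xz (fromℕ n) α (fromℕ (2 ^ d) * invScale n (suc d)) ⟩
  α * (fromℕ n * (fromℕ (2 ^ d) * invScale n (suc d)))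
    ≡⟨ cong (α *_) (k*2^d*invScale[1+d]≡½ n d) ⟩
  α * ½ ∎
  where open ≡-Reasoning

satisfied⇒separated : ∀ {n d} (f : Fin n → Fin d) (σ : Permutation′ d) v w → σ ⟨$⟩ʳ f v ≡ f w →
  ∀ x → crosses (labelCut f) (cube v x) (cube w (negate (applyPerm σ x))) ≡ true
satisfied⇒separated f σ v w σfv≡fw x = begin
  x (f v) xor not (applyPerm σ x (f w))          ≡⟨ cong (λ j → x (f v) xor not (applyPerm σ x j)) σfv≡fw ⟨
  x (f v) xor not (applyPerm σ x (σ ⟨$⟩ʳ f v))   ≡⟨ cong (λ b → x (f v) xor not b) (applyPerm-⟨$⟩ʳ σ x (f v)) ⟩
  x (f v) xor not (x (f v))                      ≡⟨ xor-not (x (f v)) ⟩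
  true                                           ∎
  where open ≡-Reasoning

satisfies≤separates : ∀ {n d m} (H : ULC n d m) f e x →
  ind (satisfiesᵇ H f e)
  ≤ ind (crosses (labelCut f) (cube (src H e) x) (cube (tgt H e) (negate (applyPerm (perm H e) x))))
satisfies≤separates H f e x with perm H e ⟨$⟩ʳ f (src H e) ≟ f (tgt H e)
... | yes σfv≡fw = ≤-reflexive (cong ind (sym (satisfied⇒separated f (perm H e) (src H e) (tgt H e) σfv≡fw x)))
... | no _       = ind-nonNeg _

-- satCount counts with a function local to its definition, so induction on m
-- has to go through the instance without its first edge.
dropFirstEdge : ∀ {n d m} → ULC n d (suc m) → ULC n d m
dropFirstEdge H = record
  { src  = λ e → src H (suc e)
  ; tgt  = λ e → tgt H (suc e)
  ; perm = λ e → perm H (suc e)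
  }

sumFin-satisfies : ∀ {n d m} (H : ULC n d m) f → sumFin m (λ e → ind (satisfiesᵇ H f e)) ≡ fromℕ (satCount H f)
sumFin-satisfies {m = zero}  H f = refl
sumFin-satisfies {m = suc m} H f = step (satisfiesᵇ H f zero) (sumFin-satisfies (dropFirstEdge H) f)
  where
  step : ∀ b {q k} → q ≡ fromℕ k → ind b + q ≡ fromℕ ((if b then 1 else 0) ℕ.+ k)
  step true  {k = k} q≡k = trans (cong (_+_ 1ℚ) q≡k) (fromℕ-homo-+ 1 k)
  step false         q≡k = trans (+-identityˡ _) q≡k

satFraction≤separatedDemand : ∀ {n d m} .{{_ : NonZero m}} (H : ULC n d m) f →
                              satFraction H f ≤ separatedDemand H (labelCut f)
satFraction≤separatedDemand {n} {d} {m} H f = begin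
  + satCount H f / m
    ≡⟨ a*2^d*invScale≡a/m (satCount H f) m d ⟨
  fromℕ (satCount H f) * (fromℕ (2 ^ d) * invScale m d)
    ≡⟨ cong (_* (fromℕ (2 ^ d) * invScale m d)) (sumFin-satisfies H f) ⟨
  sumFin m (λ e → ind (satisfiesᵇ H f e)) * (fromℕ (2 ^ d) * invScale m d)
    ≡⟨ sumFin-*ʳ m (λ e → ind (satisfiesᵇ H f e)) (fromℕ (2 ^ d) * invScale m d) ⟨
  sumFin m (λ e → ind (satisfiesᵇ H f e) * (fromℕ (2 ^ d) * invScale m d))
    ≡⟨ sumFin-cong m (λ e → x∙yz≈y∙xz (ind (satisfiesᵇ H f e)) (fromℕ (2 ^ d)) (invScale m d)) ⟩
  sumFin m (λ e → fromℕ (2 ^ d) * (ind (satisfiesᵇ H f e) * invScale m d))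
    ≡⟨ sumFin-cong m (λ e → sumCube-const d (ind (satisfiesᵇ H f e) * invScale m d)) ⟨
  sumFin m (λ e → sumCube d (λ _ → ind (satisfiesᵇ H f e) * invScale m d))
    ≤⟨ sumFin-mono-≤ m (λ e → sumCube-mono-≤ d (λ x →
         *-monoʳ-≤-nonNeg (invScale m d) {{invScale-nonNeg m d}} (satisfies≤separates H f e x))) ⟩
  separatedDemand H (labelCut f)
    ∎
  where open ℚ.≤-Reasoning

noLabelling : ∀ {n} .{{_ : NonZero n}} → ¬ (Fin n → Fin 0)
noLabelling {suc n} f with f zero
... | ()

lemma5p4 : {n d m Δ : ℕ} .{{_ : NonZero n}} .{{_ : NonZero m}}
    (H : ULC n d m) → IsNice H Δ → (α η : ℚ) → 0ℚ < α →
    (f : Fin n → Fin d) → 1ℚ - η ≤ satFraction H f →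
    Σ (Cut n d) (λ S → (capacity α S ≤ 1ℚ + α * ½) × (1ℚ - η ≤ separatedDemand H S))
lemma5p4 {d = zero}  _ _ _ _ _ f _ = ⊥-elim (noLabelling f)
lemma5p4 {d = suc d} H _ α _ _ f 1-η≤sat =
  labelCut f , ≤-reflexive capacity≡ , ≤-trans 1-η≤sat (satFraction≤separatedDemand H f)
  where
  capacity≡ : capacity α (labelCut f) ≡ 1ℚ + α * ½
  capacity≡ = cong₂ _+_ (starCapacity-s-t-cut (labelCut f) refl refl) (cubeCapacity-labelCut α f)
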